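{- For every term $M$ of the $\lambda\Omega^+$-calculus and every term $K$ of the typed $\lambda\beta\eta$-calculus (i.e. containing no $\Omega_\sigma$): if $\vdash_{\lambda\Omega^+}M=K$ then $\vdash_{\lambda\Omega}\widetilde{M}=K$.
   Context: Simple types are built from a ground type $o$ with $\to$; a type $\sigma_1\to\cdots\to\sigma_n\to o$ is called $n$-ary. The $\lambda\Omega^+$-calculus is the typed (Church-style) $\lambda\beta\eta$-calculus extended with constants $\Omega_\sigma:\sigma$ for every type $\sigma$, with no additional conversion rules. The $\lambda\Omega$-calculus is the subsystem with only the constant $\Omega=\Omega_o$. For $n$-ary $\sigma$ let $\widetilde{\Omega}_\sigma=\lambda x_1\ldots x_n.\Omega$ (a $\lambda\Omega$ term). For a $\lambda\Omega^+$ term $M$, $\widetilde{M}$ is the $\lambda\Omega$ term obtained by replacing every occurrence of each $\Omega_\sigma$ in $M$ by $\widetilde{\Omega}_\sigma$. -}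

module Defs where

open import Data.List using (List; []; _∷_)
open import Data.Unit using (⊤; tt)
open import Data.Empty using (⊥; ⊥-elim)
open import Relation.Binary.PropositionalEquality using (_≡_; refl)

infixr 7 _⇒_
data Ty : Set where
  o   : Ty
  _⇒_ : Ty → Ty → Ty

Ctx : Set
Ctx = List Ty

infix 4 _∋_
data _∋_ : Ctx → Ty → Set where
  here  : ∀ {Γ σ} → (σ ∷ Γ) ∋ σ
  there : ∀ {Γ σ τ} → Γ ∋ σ → (τ ∷ Γ) ∋ σ

Consts : Set₁
Consts = Ty → Set

data Tm (C : Consts) (Γ : Ctx) : Ty → Set where
  var : ∀ {σ} → Γ ∋ σ → Tm C Γ σ
  lam : ∀ {σ τ} → Tm C (σ ∷ Γ) τ → Tm C Γ (σ ⇒ τ)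
  app : ∀ {σ τ} → Tm C Γ (σ ⇒ τ) → Tm C Γ σ → Tm C Γ τ
  con : ∀ {σ} → C σ → Tm C Γ σ

Ren : Ctx → Ctx → Set
Ren Γ Δ = ∀ {σ} → Γ ∋ σ → Δ ∋ σ

extR : ∀ {Γ Δ τ} → Ren Γ Δ → Ren (τ ∷ Γ) (τ ∷ Δ)
extR ρ here      = here
extR ρ (there x) = there (ρ x)

rename : ∀ {C Γ Δ σ} → Ren Γ Δ → Tm C Γ σ → Tm C Δ σ
rename ρ (var x)   = var (ρ x)
rename ρ (lam t)   = lam (rename (extR ρ) t)
rename ρ (app t u) = app (rename ρ t) (rename ρ u)
rename ρ (con c)   = con c

weaken : ∀ {C Γ σ τ} → Tm C Γ σ → Tm C (τ ∷ Γ) σ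
weaken = rename there

Sub : Consts → Ctx → Ctx → Set
Sub C Γ Δ = ∀ {σ} → Γ ∋ σ → Tm C Δ σ

extS : ∀ {C Γ Δ τ} → Sub C Γ Δ → Sub C (τ ∷ Γ) (τ ∷ Δ)
extS s here      = var here
extS s (there x) = weaken (s x)

subst : ∀ {C Γ Δ σ} → Sub C Γ Δ → Tm C Γ σ → Tm C Δ σ
subst s (var x)   = s x
subst s (lam t)   = lam (subst (extS s) t)
subst s (app t u) = app (subst s t) (subst s u)
subst s (con c)   = con c

single : ∀ {C Γ τ} → Tm C Γ τ → Sub C (τ ∷ Γ) Γ
single u here      = u
single u (there x) = var x

_[_] : ∀ {C Γ σ τ} → Tm C (τ ∷ Γ) σ → Tm C Γ τ → Tm C Γ σ
t [ u ] = subst (single u) t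

-- βη-convertibility (provable equality) in the calculus with constants C;
-- no conversion rules for constants.
data Conv (C : Consts) : ∀ {Γ σ} → Tm C Γ σ → Tm C Γ σ → Set where
  β     : ∀ {Γ} {σ τ} (t : Tm C (σ ∷ Γ) τ) (u : Tm C Γ σ) →
          Conv C (app (lam t) u) (t [ u ])
  η     : ∀ {Γ} {σ τ} (t : Tm C Γ (σ ⇒ τ)) →
          Conv C t (lam (app (weaken t) (var here)))
  refl≈ : ∀ {Γ} {σ} (t : Tm C Γ σ) → Conv C t t
  sym≈  : ∀ {Γ} {σ} {t u : Tm C Γ σ} → Conv C t u → Conv C u t
  trans≈ : ∀ {Γ} {σ} {t u v : Tm C Γ σ} → Conv C t u → Conv C u v → Conv C t v
  app≈  : ∀ {Γ} {σ τ} {t t' : Tm C Γ (σ ⇒ τ)} {u u' : Tm C Γ σ} →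
          Conv C t t' → Conv C u u' → Conv C (app t u) (app t' u')
  lam≈  : ∀ {Γ} {σ τ} {t t' : Tm C (σ ∷ Γ) τ} →
          Conv C t t' → Conv C (lam t) (lam t')

-- The three calculi
-- λΩ⁺ : one constant Ω_σ for every type σ
ΩPlus : Consts
ΩPlus _ = ⊤

-- λΩ : only the constant Ω = Ω_o
ΩOnly : Consts
ΩOnly σ = σ ≡ o

NoConst : Consts
NoConst _ = ⊥

Ωσ : ∀ {Γ} (σ : Ty) → Tm ΩPlus Γ σ
Ωσ σ = con tt

Ω : ∀ {Γ} → Tm ΩOnly Γ o
Ω = con refl

embed : ∀ {C Γ σ} → Tm NoConst Γ σ → Tm C Γ σ
embed (var x)   = var x
embed (lam t)   = lam (embed t)
embed (app t u) = app (embed t) (embed u)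
embed (con ())

Ω̃ : ∀ {Γ} (σ : Ty) → Tm ΩOnly Γ σ
Ω̃ o       = Ω
Ω̃ (σ ⇒ τ) = lam (Ω̃ τ)

tilde : ∀ {Γ σ} → Tm ΩPlus Γ σ → Tm ΩOnly Γ σ
tilde (var x)   = var x
tilde (lam t)   = lam (tilde t)
tilde (app t u) = app (tilde t) (tilde u)
tilde {σ = σ} (con _) = Ω̃ σ

{-# OPTIONS --safe #-}
module Submission where

-- The translation M ↦ M̃ is a homomorphism on terms that commutes with renaming
-- and substitution, because each Ω̃_σ is closed. Hence it maps βη-conversions of
-- λΩ⁺ to βη-conversions of λΩ, and it fixes every pure term.

open import Defs
open import Data.List using (_∷_)
open import Relation.Binary.PropositionalEquality as ≡ using (_≡_; refl; cong; cong₂; sym; trans)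

rename-Ω̃ : ∀ {Γ Δ} (ρ : Ren Γ Δ) (σ : Ty) → rename ρ (Ω̃ σ) ≡ Ω̃ σ
rename-Ω̃ ρ o       = refl
rename-Ω̃ ρ (σ ⇒ τ) = cong lam (rename-Ω̃ (extR ρ) τ)

subst-Ω̃ : ∀ {Γ Δ} (s : Sub ΩOnly Γ Δ) (σ : Ty) → subst s (Ω̃ σ) ≡ Ω̃ σ
subst-Ω̃ s o       = refl
subst-Ω̃ s (σ ⇒ τ) = cong lam (subst-Ω̃ (extS s) τ)

tilde-rename : ∀ {Γ Δ σ} (ρ : Ren Γ Δ) (t : Tm ΩPlus Γ σ) →
               tilde (rename ρ t) ≡ rename ρ (tilde t)
tilde-rename ρ (var x)           = refl
tilde-rename ρ (lam t)           = cong lam (tilde-rename (extR ρ) t)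
tilde-rename ρ (app t u)         = cong₂ app (tilde-rename ρ t) (tilde-rename ρ u)
tilde-rename {σ = σ} ρ (con _)   = sym (rename-Ω̃ ρ σ)

tilde-subst : ∀ {Γ Δ σ} (s : Sub ΩPlus Γ Δ) (s̃ : Sub ΩOnly Γ Δ) →
              (∀ {τ} (x : Γ ∋ τ) → tilde (s x) ≡ s̃ x) →
              (t : Tm ΩPlus Γ σ) → tilde (subst s t) ≡ subst s̃ (tilde t)
tilde-subst s s̃ s≗s̃ (var x)         = s≗s̃ x
tilde-subst s s̃ s≗s̃ (lam t)         = cong lam (tilde-subst (extS s) (extS s̃) ext-s≗s̃ t)
  where
  ext-s≗s̃ : ∀ {τ} (x : _ ∋ τ) → tilde (extS s x) ≡ extS s̃ x
  ext-s≗s̃ here      = refl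
  ext-s≗s̃ (there x) = trans (tilde-rename there (s x)) (cong weaken (s≗s̃ x))
tilde-subst s s̃ s≗s̃ (app t u)       = cong₂ app (tilde-subst s s̃ s≗s̃ t) (tilde-subst s s̃ s≗s̃ u)
tilde-subst {σ = σ} s s̃ s≗s̃ (con _) = sym (subst-Ω̃ s̃ σ)

tilde-[] : ∀ {Γ σ τ} (t : Tm ΩPlus (τ ∷ Γ) σ) (u : Tm ΩPlus Γ τ) →
           tilde (t [ u ]) ≡ tilde t [ tilde u ]
tilde-[] t u = tilde-subst (single u) (single (tilde u)) tilde-single t
  where
  tilde-single : ∀ {τ} (x : _ ∋ τ) → tilde (single u x) ≡ single (tilde u) x
  tilde-single here      = refl
  tilde-single (there x) = refl

tilde-embed : ∀ {Γ σ} (K : Tm NoConst Γ σ) → tilde (embed K) ≡ embed K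
tilde-embed (var x)   = refl
tilde-embed (lam t)   = cong lam (tilde-embed t)
tilde-embed (app t u) = cong₂ app (tilde-embed t) (tilde-embed u)
tilde-embed (con ())

tilde-cong : ∀ {Γ σ} {M N : Tm ΩPlus Γ σ} →
             Conv ΩPlus M N → Conv ΩOnly (tilde M) (tilde N)
tilde-cong (β t u) rewrite tilde-[] t u = β (tilde t) (tilde u)
tilde-cong (η t) =
  ≡.subst (λ t′ → Conv ΩOnly (tilde t) (lam (app t′ (var here))))
          (sym (tilde-rename there t)) (η (tilde t))
tilde-cong (refl≈ t)    = refl≈ (tilde t)
tilde-cong (sym≈ p)     = sym≈ (tilde-cong p)
tilde-cong (trans≈ p q) = trans≈ (tilde-cong p) (tilde-cong q)
tilde-cong (app≈ p q)   = app≈ (tilde-cong p) (tilde-cong q)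
tilde-cong (lam≈ p)     = lam≈ (tilde-cong p)

lemma2 : ∀ {Γ : Ctx} {σ : Ty} (M : Tm ΩPlus Γ σ) (K : Tm NoConst Γ σ) →
           Conv ΩPlus M (embed K) → Conv ΩOnly (tilde M) (embed K)
lemma2 M K M≈K = ≡.subst (Conv ΩOnly (tilde M)) (tilde-embed K) (tilde-cong M≈K)
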